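{- Let $(L_n)_{n\ge 0}$ be the Lucas sequence and $\Phi=\frac{1+\sqrt5}{2}$. Every positive integer $N$ has exactly one representation $N=\sum_{i\in I}L_i$ with $I\subseteq\{0,1,2,\ldots\}$ finite, no two elements of $I$ consecutive integers, and $I$ not containing both $0$ and $2$; call the terms $L_i$, $i\in I$, the summands of the partition of $N$. For $k\ge 0$ let $Z(k)$ be the set of positive integers whose partition has $L_k$ as a summand. Then $$Z(k) = \begin{cases}\left\{2+3n+\left\lfloor\frac{n+1}{\Phi}\right\rfloor : n\ge 0\right\}, & k = 0,\\[2pt] \left\{3n+\left\lfloor\frac{n+\Phi^2}{\Phi}\right\rfloor : n\ge 0\right\}, & k = 1,\\[2pt] \left\{L_k\left\lfloor\frac{n+\Phi^2}{\Phi}\right\rfloor+ nL_{k+1}+j : n\ge 0,\ 0\le j\le L_{k-1}-1\right\}, & k \ge 2. \end{cases}$$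
   Context: The Lucas sequence is defined by $L_0=2$, $L_1=1$, and $L_n=L_{n-1}+L_{n-2}$ for $n\ge 2$. The existence and uniqueness of the representation described (non-consecutive indices, not using both $L_0$ and $L_2$) is a known fact. -}

module Defs where

open import Data.Nat as ℕ using (ℕ; zero; suc)
open import Data.Integer as ℤ using (ℤ; +_)
open import Data.List using (List; []; _∷_; map)
open import Data.Nat.ListAction using (sum)
open import Data.List.Membership.Propositional using (_∈_)
open import Data.Product using (_×_; Σ; ∃; ∃-syntax)
open import Data.Sum using (_⊎_)
open import Relation.Nullary using (¬_)
open import Relation.Binary.PropositionalEquality using (_≡_)

L : ℕ → ℕ
L zero = 2
L (suc zero) = 1
L (suc (suc n)) = L (suc n) ℕ.+ L n

-- A finite index set I ⊆ ℕ is represented by the strictly increasing list of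
-- its elements.  "Gapped I" says the list is strictly increasing with no two
-- consecutive integers (each next element exceeds the previous one by ≥ 2).
data Gapped : List ℕ → Set where
  []  : Gapped []
  [_] : (x : ℕ) → Gapped (x ∷ [])
  _∷_ : ∀ {x y xs} → suc x ℕ.< y → Gapped (y ∷ xs) → Gapped (x ∷ y ∷ xs)

Admissible : List ℕ → Set
Admissible I = Gapped I × ¬ (0 ∈ I × 2 ∈ I)

Z : ℕ → ℕ → Set
Z k N = 0 ℕ.< N × ∃[ I ] (Admissible I × sum (map L I) ≡ N × k ∈ I)

-- NonNeg√5 p q  ⇔  p + q√5 ≥ 0   (as real numbers)
NonNeg√5 : ℤ → ℤ → Set
NonNeg√5 p q =
    (+ 0 ℤ.≤ p × + 0 ℤ.≤ q)
  ⊎ (+ 0 ℤ.≤ p × q ℤ.< + 0 × + 5 ℤ.* (q ℤ.* q) ℤ.≤ p ℤ.* p)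
  ⊎ (p ℤ.< + 0 × + 0 ℤ.< q × p ℤ.* p ℤ.≤ + 5 ℤ.* (q ℤ.* q))

-- NonNegΦ a b  ⇔  a + bΦ ≥ 0   (since 2(a + bΦ) = (2a + b) + b√5)
NonNegΦ : ℤ → ℤ → Set
NonNegΦ a b = NonNeg√5 (+ 2 ℤ.* a ℤ.+ b) b

-- IsFloorDivΦ a b m  ⇔  m = ⌊(a + bΦ)/Φ⌋, i.e. mΦ ≤ a + bΦ < (m+1)Φ
IsFloorDivΦ : ℤ → ℤ → ℕ → Set
IsFloorDivΦ a b m =
  NonNegΦ a (b ℤ.- + m) × ¬ NonNegΦ a (b ℤ.- + suc m)

-- An admissible set containing k splits as lo ∪ {k} ∪ hi, with lo below k − 1 and hi above k + 1.
-- The sums over the possible lower parts are exactly the j < L (k − 1): a telescoping bound gives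
-- one inclusion, the greedy Lucas expansion the other. An upper part is a gapped set of positions
-- ≥ k + 2, i.e. a Zeckendorf word w; as L obeys the Fibonacci recurrence, its sum is
-- L k · m + L (k + 1) · n, where n and m are the sums of fib i and fib (i − 1) over the positions of w
-- shifted to start at 2. Every n arises this way, and m = ⌊(n + 1)/Φ⌋ since (n + 1)/Φ stays
-- strictly between m and m + 1 as the word grows. For k ≥ 1 the summand L k itself turns m into
-- m + 1 = ⌊(n + Φ²)/Φ⌋; for k = 0 the index 2 is excluded, so hi starts at 3 and sums to m + 3n.

module Submission where

open import Defs
open import Data.Nat using (ℕ; zero; suc; _+_; _*_; _∸_; _<_; _≤_; z≤n; s≤s; _≤?_)
open import Data.Nat.Properties
open import Algebra.Properties.CommutativeSemigroup +-commutativeSemigroup using (xy∙z≈y∙xz)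
open import Data.Nat.ListAction using (sum)
open import Data.Nat.ListAction.Properties using (sum-++)
open import Data.Nat.Tactic.RingSolver using (solve-∀)
open import Data.Integer as ℤ using (+_; -[1+_]; _⊖_; +≤+; -<+)
import Data.Integer.Properties as ℤ
open import Data.List using (List; []; _∷_; _++_; map)
open import Data.List.Properties using (map-++)
open import Data.List.Relation.Unary.All as All using (All; []; _∷_)
open import Data.List.Relation.Unary.All.Properties using (++⁺)
open import Data.List.Relation.Unary.Any using (here; there)
open import Data.List.Membership.Propositional using (_∈_)
open import Data.List.Membership.Propositional.Properties using (∈-++⁺ˡ; ∈-++⁺ʳ; ∈-++⁻; ∉[])
open import Data.Product using (_×_; _,_; ∃₂; ∃-syntax)
open import Data.Sum using (inj₁; inj₂)
open import Data.Empty using (⊥-elim)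
open import Function using (id; _∘_)
open import Function.Bundles using (_⇔_; mk⇔; Equivalence)
open import Relation.Nullary using (¬_; yes; no)
open import Relation.Binary.PropositionalEquality

infix 4 ⌊_/Φ⌋≡_

-- m = ⌊x/Φ⌋ iff mΦ ≤ x < (m + 1)Φ, and since Φ² = Φ + 1, mΦ ≤ x iff m(x + m) ≤ x².
⌊_/Φ⌋≡_ : ℕ → ℕ → Set
⌊ x /Φ⌋≡ m = m * (x + m) ≤ x * x × x * x < suc m * (x + suc m)

m+n≡o+p⇒p≤m⇒n≤o : ∀ {m n o p} → m + n ≡ o + p → p ≤ m → n ≤ o
m+n≡o+p⇒p≤m⇒n≤o {m} {n} {o} {p} eq p≤m = +-cancelˡ-≤ m n o (begin
  m + n ≡⟨ eq ⟩
  o + p ≤⟨ +-monoʳ-≤ o p≤m ⟩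
  o + m ≡⟨ +-comm o m ⟩
  m + o ∎)
  where open ≤-Reasoning

m+n≡o+p⇒n<p⇒o<m : ∀ {m n o p} → m + n ≡ o + p → n < p → o < m
m+n≡o+p⇒n<p⇒o<m {m} {n} {o} {p} eq n<p = +-cancelʳ-< p o m (begin-strict
  o + p ≡⟨ sym eq ⟩
  m + n <⟨ +-monoʳ-< m n<p ⟩
  m + p ∎)
  where open ≤-Reasoning

-- With d + m = 2x, the inequality mΦ ≤ x reads m√5 ≤ d; squaring it gives m(x + m) ≤ x².
5m²≤d²⇔m[x+m]≤x² : ∀ {x m d} → d + m ≡ 2 * x → 5 * (m * m) ≤ d * d ⇔ m * (x + m) ≤ x * x
5m²≤d²⇔m[x+m]≤x² {x} {m} {d} d+m≡2x = mk⇔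
    (λ le → *-cancelˡ-≤ 4 (m+n≡o+p⇒p≤m⇒n≤o (sym identity) le))
    (λ le → m+n≡o+p⇒p≤m⇒n≤o identity (*-monoʳ-≤ 4 le))
  where
  identity : 4 * (x * x) + 5 * (m * m) ≡ d * d + 4 * (m * (x + m))
  identity = begin
    4 * (x * x) + 5 * (m * m)                ≡⟨ square-double x m ⟩
    (2 * x) * (2 * x) + 5 * (m * m)          ≡⟨ cong (λ t → t * t + 5 * (m * m)) (sym d+m≡2x) ⟩
    (d + m) * (d + m) + 5 * (m * m)          ≡⟨ expand d m ⟩
    d * d + (2 * m * (d + m) + 4 * (m * m))  ≡⟨ cong (λ t → d * d + (2 * m * t + 4 * (m * m))) d+m≡2x ⟩
    d * d + (2 * m * (2 * x) + 4 * (m * m))  ≡⟨ collect d x m ⟩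
    d * d + 4 * (m * (x + m))                ∎
    where
    open ≡-Reasoning
    square-double : ∀ x m → 4 * (x * x) + 5 * (m * m) ≡ (2 * x) * (2 * x) + 5 * (m * m)
    square-double = solve-∀
    expand : ∀ d m → (d + m) * (d + m) + 5 * (m * m) ≡ d * d + (2 * m * (d + m) + 4 * (m * m))
    expand = solve-∀
    collect : ∀ d x m → d * d + (2 * m * (2 * x) + 4 * (m * m)) ≡ d * d + 4 * (m * (x + m))
    collect = solve-∀

m[x+m]≤x²⇒m≤x : ∀ {x m} → m * (x + m) ≤ x * x → m ≤ x
m[x+m]≤x²⇒m≤x {x} {m} le = ≮⇒≥ λ x<m → <⇒≱ (begin-strict
  x * x        <⟨ *-mono-< x<m x<m ⟩
  m * m        ≤⟨ *-monoʳ-≤ m (m≤n+m m x) ⟩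
  m * (x + m)  ∎) le
  where open ≤-Reasoning

0≤m⊖n⇒n≤m : ∀ {m n} → + 0 ℤ.≤ m ⊖ n → n ≤ m
0≤m⊖n⇒n≤m {m} {n} 0≤m⊖n with n ≤? m
... | yes n≤m = n≤m
... | no n≰m with m ⊖ n | ℤ.sign-⊖-≰ n≰m | 0≤m⊖n
...   | + _      | () | _
...   | -[1+ _ ] | _  | ()

nonNegΦ-neg⇔ : ∀ x m → NonNegΦ (+ x) -[1+ m ] ⇔ suc m * (x + suc m) ≤ x * x
nonNegΦ-neg⇔ x m = mk⇔ to from
  where
  p≡2x⊖1+m : + 2 ℤ.* + x ℤ.+ -[1+ m ] ≡ 2 * x ⊖ suc m
  p≡2x⊖1+m = cong (ℤ._+ -[1+ m ]) (sym (ℤ.pos-* 2 x))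

  module _ (1+m≤2x : suc m ≤ 2 * x) where
    d : ℕ
    d = 2 * x ∸ suc m

    p≡d : + 2 ℤ.* + x ℤ.+ -[1+ m ] ≡ + d
    p≡d = trans p≡2x⊖1+m (ℤ.⊖-≥ 1+m≤2x)

    5q²≤p²⇔ : + 5 ℤ.* (-[1+ m ] ℤ.* -[1+ m ]) ℤ.≤ (+ 2 ℤ.* + x ℤ.+ -[1+ m ]) ℤ.* (+ 2 ℤ.* + x ℤ.+ -[1+ m ])
              ⇔ suc m * (x + suc m) ≤ x * x
    5q²≤p²⇔ rewrite p≡d | sym (ℤ.pos-* d d) =
      mk⇔ (to′ ∘ ℤ.drop‿+≤+) (+≤+ ∘ from′)
      where open Equivalence (5m²≤d²⇔m[x+m]≤x² {x} {suc m} {d} (m∸n+n≡m 1+m≤2x)) renaming (to to to′; from to from′)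

  to : NonNegΦ (+ x) -[1+ m ] → suc m * (x + suc m) ≤ x * x
  to (inj₁ (_ , ()))
  to (inj₂ (inj₁ (0≤p , _ , 5q²≤p²))) =
    Equivalence.to (5q²≤p²⇔ (0≤m⊖n⇒n≤m (subst (+ 0 ℤ.≤_) p≡2x⊖1+m 0≤p))) 5q²≤p²
  to (inj₂ (inj₂ (_ , () , _)))

  from : suc m * (x + suc m) ≤ x * x → NonNegΦ (+ x) -[1+ m ]
  from le = inj₂ (inj₁ (subst (+ 0 ℤ.≤_) (sym (p≡d 1+m≤2x)) (+≤+ z≤n) , -<+ , Equivalence.from (5q²≤p²⇔ 1+m≤2x) le))
    where
    1+m≤2x : suc m ≤ 2 * x
    1+m≤2x = ≤-trans (m[x+m]≤x²⇒m≤x le) (m≤m+n x (x + 0))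

nonNegΦ⇔ : ∀ n m → NonNegΦ (+ suc n) (+ 0 ℤ.- + m) ⇔ m * (suc n + m) ≤ suc n * suc n
nonNegΦ⇔ n zero    = mk⇔ (λ _ → z≤n) (λ _ → inj₁ (+≤+ z≤n , +≤+ z≤n))
nonNegΦ⇔ n (suc m) = nonNegΦ-neg⇔ (suc n) m

isFloorDivΦ⇔ : ∀ n m → IsFloorDivΦ (+ suc n) (+ 0) m ⇔ ⌊ suc n /Φ⌋≡ m
isFloorDivΦ⇔ n m = mk⇔
  (λ (lower , upper) → to (nonNegΦ⇔ n m) lower , ≰⇒> (upper ∘ from (nonNegΦ⇔ n (suc m))))
  (λ (lower , upper) → from (nonNegΦ⇔ n m) lower , <⇒≱ upper ∘ to (nonNegΦ⇔ n (suc m)))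
  where open Equivalence

isFloorDivΦ-suc : ∀ n m → IsFloorDivΦ (+ suc n) (+ 1) (suc m) ≡ IsFloorDivΦ (+ suc n) (+ 0) m
isFloorDivΦ-suc n zero    = refl
isFloorDivΦ-suc n (suc m) = refl

isFloorDivΦ-Φ²⇔ : ∀ n m → IsFloorDivΦ (+ suc n) (+ 1) m ⇔ (∃[ m′ ] m ≡ suc m′ × ⌊ suc n /Φ⌋≡ m′)
isFloorDivΦ-Φ²⇔ n zero = mk⇔ (λ (_ , upper) → ⊥-elim (upper (inj₁ (+≤+ z≤n , +≤+ z≤n)))) λ { (_ , () , _) }
isFloorDivΦ-Φ²⇔ n (suc m) = mk⇔
  (λ fl → m , refl , Equivalence.to (isFloorDivΦ⇔ n m) (subst id (isFloorDivΦ-suc n m) fl))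
  (λ { (_ , refl , fl) → subst id (sym (isFloorDivΦ-suc n m)) (Equivalence.from (isFloorDivΦ⇔ n m) fl) })

⌊/Φ⌋-unique : ∀ {x m m′} → ⌊ x /Φ⌋≡ m → ⌊ x /Φ⌋≡ m′ → m ≡ m′
⌊/Φ⌋-unique fl fl′ = ≤-antisym (⌊/Φ⌋-mono fl fl′) (⌊/Φ⌋-mono fl′ fl)
  where
  ⌊/Φ⌋-mono : ∀ {x m m′} → ⌊ x /Φ⌋≡ m → ⌊ x /Φ⌋≡ m′ → m ≤ m′
  ⌊/Φ⌋-mono {x} (lower , _) (_ , upper′) =
    ≮⇒≥ λ m′<m → <⇒≱ upper′ (≤-trans (*-mono-≤ m′<m (+-monoʳ-≤ x m′<m)) lower)

FibonacciRecurrence : (ℕ → ℕ) → Set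
FibonacciRecurrence X = ∀ i → X (2 + i) ≡ X (1 + i) + X i

fib : ℕ → ℕ
fib 0 = 0
fib 1 = 1
fib (suc (suc n)) = fib (suc n) + fib n

-- A word describes a set of pairwise non-consecutive positions ≥ c: 0∷ skips position c,
-- 10∷ takes c and skips c + 1.
data Word : Set where
  []   : Word
  0∷_  : Word → Word
  10∷_ : Word → Word

positions : ℕ → Word → List ℕ
positions c []       = []
positions c (0∷ w)   = positions (suc c) w
positions c (10∷ w)  = c ∷ positions (2 + c) w

-- value w = Σ fib i and shiftedValue w = Σ fib (i ∸ 1) over i ∈ positions 2 w (sum-positions).
value shiftedValue : Word → ℕ
value []        = 0
value (0∷ w)    = value w + shiftedValue w
value (10∷ w)   = suc (value w + shiftedValue w + value w)
shiftedValue []       = 0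
shiftedValue (0∷ w)   = value w
shiftedValue (10∷ w)  = suc (value w + shiftedValue w)

sum-positions : ∀ {X} → FibonacciRecurrence X → ∀ c w →
                sum (map X (positions (2 + c) w)) ≡ X c * shiftedValue w + X (1 + c) * value w
sum-positions {X} rec c [] = empty (X c) (X (1 + c))
  where
  empty : ∀ a b → 0 ≡ a * 0 + b * 0
  empty = solve-∀
sum-positions {X} rec c (0∷ w)
  rewrite sum-positions {X} rec (1 + c) w | rec c = skip (X c) (X (1 + c)) (value w) (shiftedValue w)
  where
  skip : ∀ a b n m → b * m + (b + a) * n ≡ a * n + b * (n + m)
  skip = solve-∀
sum-positions {X} rec c (10∷ w)
  rewrite sum-positions {X} rec (2 + c) w | rec (1 + c) | rec c = take (X c) (X (1 + c)) (value w) (shiftedValue w)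
  where
  take : ∀ a b n m → (b + a) + ((b + a) * m + ((b + a) + b) * n) ≡ a * suc (n + m) + b * suc (n + m + n)
  take = solve-∀

-- (n + 1)/Φ lies strictly between m and m + 1; strictness and m ≤ n make this invariant under 0∷ and 10∷.
Bracket : ℕ → ℕ → Set
Bracket n m = m ≤ n × m * (suc n + m) < suc n * suc n × suc n * suc n < suc m * (suc n + suc m)

Bracket-0∷ : ∀ {n m} → Bracket n m → Bracket (n + m) n
Bracket-0∷ {n} {m} (m≤n , lower , upper) =
  m≤m+n n m ,
  m+n≡o+p⇒n<p⇒o<m (sym (identity₂ n m)) (+-mono-<-≤ upper (≤-trans m≤n (m≤m+n n (n + 0)))) ,
  m+n≡o+p⇒n<p⇒o<m (identity₁ n m) lower
  where
  identity₁ : ∀ n m → suc n * (suc (n + m) + suc n) + m * (suc n + m)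
                    ≡ suc (n + m) * suc (n + m) + suc n * suc n
  identity₁ = solve-∀
  identity₂ : ∀ n m → n * (suc (n + m) + n) + (suc m * (suc n + suc m) + 2 * n)
                    ≡ suc (n + m) * suc (n + m) + (suc n * suc n + m)
  identity₂ = solve-∀

Bracket-10∷ : ∀ {n m} → Bracket n m → Bracket (suc (n + m + n)) (suc (n + m))
Bracket-10∷ {n} {m} (m≤n , lower , upper) =
  s≤s (m≤m+n (n + m) n) ,
  m+n≡o+p⇒n<p⇒o<m (identity₁ n m) lower ,
  m+n≡o+p⇒n<p⇒o<m (identity₂ n m) (<-≤-trans upper (m≤m+n _ _))
  where
  identity₁ : ∀ n m → suc (suc (n + m + n)) * suc (suc (n + m + n)) + m * (suc n + m)
                    ≡ suc (n + m) * (suc (suc (n + m + n)) + suc (n + m)) + suc n * suc n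
  identity₁ = solve-∀
  identity₂ : ∀ n m → suc (suc (n + m)) * (suc (suc (n + m + n)) + suc (suc (n + m))) + suc n * suc n
                    ≡ suc (suc (n + m + n)) * suc (suc (n + m + n)) + (suc m * (suc n + suc m) + (3 * suc n + m))
  identity₂ = solve-∀

bracket-value : ∀ w → Bracket (value w) (shiftedValue w)
bracket-value []       = z≤n , s≤s z≤n , s≤s (s≤s z≤n)
bracket-value (0∷ w)   = Bracket-0∷ (bracket-value w)
bracket-value (10∷ w)  = Bracket-10∷ (bracket-value w)

shiftedValue-floor : ∀ w → ⌊ suc (value w) /Φ⌋≡ shiftedValue w
shiftedValue-floor w with bracket-value w
... | _ , lower , upper = <⇒≤ lower , upper

data GappedFrom : ℕ → List ℕ → Set where
  []  : ∀ {b} → GappedFrom b []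
  _∷_ : ∀ {b x xs} → b ≤ x → GappedFrom (2 + x) xs → GappedFrom b (x ∷ xs)

GappedFrom-weaken : ∀ {a b xs} → a ≤ b → GappedFrom b xs → GappedFrom a xs
GappedFrom-weaken a≤b []           = []
GappedFrom-weaken a≤b (b≤x ∷ g)    = ≤-trans a≤b b≤x ∷ g

GappedFrom-∈ : ∀ {a k xs} → GappedFrom a xs → k ∈ xs → a ≤ k
GappedFrom-∈ (a≤k ∷ _) (here refl) = a≤k
GappedFrom-∈ (a≤x ∷ g) (there k∈) = ≤-trans a≤x (≤-trans (m≤n+m _ 2) (GappedFrom-∈ g k∈))

GappedFrom-suc : ∀ {c xs} → GappedFrom c xs → ¬ c ∈ xs → GappedFrom (suc c) xs
GappedFrom-suc []          _   = []
GappedFrom-suc (c≤x ∷ g)   c∉  = ≤∧≢⇒< c≤x (c∉ ∘ here) ∷ g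

GappedFrom-++ : ∀ {a k lo hi} → GappedFrom a lo → All (λ x → 2 + x ≤ k) lo → a ≤ k →
                GappedFrom (2 + k) hi → GappedFrom a (lo ++ k ∷ hi)
GappedFrom-++ []           []            a≤k ghi = a≤k ∷ ghi
GappedFrom-++ (a≤x ∷ glo)  (x<k ∷ lo<k)  _   ghi = a≤x ∷ GappedFrom-++ glo lo<k x<k ghi

split-at : ∀ {a k xs} → GappedFrom a xs → k ∈ xs →
           ∃₂ λ lo hi → xs ≡ lo ++ k ∷ hi × GappedFrom a lo × All (λ x → 2 + x ≤ k) lo × GappedFrom (2 + k) hi
split-at (_ ∷ g) (here refl) = [] , _ , refl , [] , [] , g
split-at {xs = x ∷ _} (a≤x ∷ g) (there k∈) with split-at g k∈
... | lo , hi , refl , glo , lo<k , ghi = x ∷ lo , hi , refl , a≤x ∷ glo , GappedFrom-∈ g k∈ ∷ lo<k , ghi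

∈-++-∷⁻-< : ∀ {k v lo hi} → GappedFrom (2 + k) hi → v < k → v ∈ lo ++ k ∷ hi → v ∈ lo
∈-++-∷⁻-< {k} {lo = lo} ghi v<k v∈ with ∈-++⁻ lo v∈
... | inj₁ v∈lo          = v∈lo
... | inj₂ (here refl)   = ⊥-elim (<-irrefl refl v<k)
... | inj₂ (there v∈hi)  = ⊥-elim (<⇒≱ v<k (≤-trans (m≤n+m k 2) (GappedFrom-∈ ghi v∈hi)))

Gapped-∷⇒GappedFrom : ∀ {x xs} → Gapped (x ∷ xs) → GappedFrom x (x ∷ xs)
Gapped-∷⇒GappedFrom [ x ]      = ≤-refl ∷ []
Gapped-∷⇒GappedFrom (x<y ∷ g)  = ≤-refl ∷ GappedFrom-weaken x<y (Gapped-∷⇒GappedFrom g)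

Gapped⇒GappedFrom : ∀ {xs} → Gapped xs → GappedFrom 0 xs
Gapped⇒GappedFrom {[]}     []  = []
Gapped⇒GappedFrom {_ ∷ _}  g   = GappedFrom-weaken z≤n (Gapped-∷⇒GappedFrom g)

GappedFrom⇒Gapped : ∀ {a xs} → GappedFrom a xs → Gapped xs
GappedFrom⇒Gapped []                   = []
GappedFrom⇒Gapped (_ ∷ [])             = [ _ ]
GappedFrom⇒Gapped (_ ∷ g@(x<y ∷ _))    = x<y ∷ GappedFrom⇒Gapped g

GappedFrom-positions : ∀ c w → GappedFrom c (positions c w)
GappedFrom-positions c []       = []
GappedFrom-positions c (0∷ w)   = GappedFrom-weaken (n≤1+n c) (GappedFrom-positions (suc c) w)
GappedFrom-positions c (10∷ w)  = ≤-refl ∷ GappedFrom-positions (2 + c) w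

skips : ℕ → Word → Word
skips zero    w = w
skips (suc d) w = 0∷ skips d w

positions-skips : ∀ d c w → positions c (skips d w) ≡ positions (d + c) w
positions-skips zero    c w = refl
positions-skips (suc d) c w = trans (positions-skips d (suc c) w) (cong (λ t → positions t w) (+-suc d c))

GappedFrom⇒positions : ∀ {c xs} → GappedFrom c xs → ∃[ w ] positions c w ≡ xs
GappedFrom⇒positions [] = [] , refl
GappedFrom⇒positions {c} (_∷_ {x = x} c≤x g) with GappedFrom⇒positions g
... | w , refl = skips (x ∸ c) (10∷ w) , (begin
  positions c (skips (x ∸ c) (10∷ w))  ≡⟨ positions-skips (x ∸ c) c (10∷ w) ⟩
  positions (x ∸ c + c) (10∷ w)        ≡⟨ cong (λ t → positions t (10∷ w)) (m∸n+n≡m c≤x) ⟩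
  x ∷ positions (2 + x) w              ∎)
  where open ≡-Reasoning

sum-map-++-∷ : ∀ (X : ℕ → ℕ) lo k hi → sum (map X (lo ++ k ∷ hi)) ≡ sum (map X lo) + (X k + sum (map X hi))
sum-map-++-∷ X lo k hi = trans (cong sum (map-++ X lo (k ∷ hi))) (sum-++ (map X lo) (X k ∷ map X hi))

sum-map-∷ʳ : ∀ (X : ℕ → ℕ) xs k → sum (map X (xs ++ k ∷ [])) ≡ sum (map X xs) + X k
sum-map-∷ʳ X xs k = trans (sum-map-++-∷ X xs k []) (cong (_+_ (sum (map X xs))) (+-identityʳ (X k)))

module _ {X : ℕ → ℕ} (rec : FibonacciRecurrence X) (P : ℕ → ℕ → Set)
         (weaken : ∀ {t n} → P t n → P (suc t) n)
         (extend : ∀ {t n} → P t n → P (2 + t) (n + X (2 + t)))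
         (P₀ : ∀ {n} → n < X 1 → P 0 n) (P₁ : ∀ {n} → n < X 2 → P 1 n) where

  greedy-step : ∀ {t} → (∀ {n} → n < X (suc t) → P t n) → (∀ {n} → n < X (2 + t) → P (suc t) n) →
                ∀ {n} → n < X (3 + t) → P (2 + t) n
  greedy-step {t} below₀ below₁ {n} n<X with X (2 + t) ≤? n
  ... | no  X≰n = weaken (below₁ (≰⇒> X≰n))
  ... | yes X≤n = subst (P (2 + t)) (m∸n+n≡m X≤n) (extend (below₀ rest<))
    where
    rest< : n ∸ X (2 + t) < X (suc t)
    rest< = subst (n ∸ X (2 + t) <_) (m+n∸m≡n (X (2 + t)) (X (suc t)))
                  (∸-monoˡ-< (subst (n <_) (rec (suc t)) n<X) X≤n)

  greedy : ∀ t {n} → n < X (suc t) → P t n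
  greedy zero          = P₀
  greedy (suc zero)    = P₁
  greedy (suc (suc t)) = greedy-step (greedy t) (greedy (suc t))

1≤fib[1+n] : ∀ n → 1 ≤ fib (suc n)
1≤fib[1+n] zero    = s≤s z≤n
1≤fib[1+n] (suc n) = ≤-trans (1≤fib[1+n] n) (m≤m+n _ _)

n<fib[2+n] : ∀ n → n < fib (2 + n)
n<fib[2+n] zero    = s≤s z≤n
n<fib[2+n] (suc n) = subst (_≤ fib (3 + n)) (+-comm (suc n) 1) (+-mono-≤ (n<fib[2+n] n) (1≤fib[1+n] n))

FibRepresentation : ℕ → ℕ → Set
FibRepresentation t n = ∃[ xs ] GappedFrom 2 xs × All (_≤ t) xs × sum (map fib xs) ≡ n

fib-representation : ∀ t {n} → n < fib (suc t) → FibRepresentation t n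
fib-representation = greedy {fib} (λ _ → refl) FibRepresentation weaken extend empty empty
  where
  empty : ∀ {t n} → n < 1 → FibRepresentation t n
  empty {n = zero}  _         = [] , [] , [] , refl
  empty {n = suc _} (s≤s ())
  weaken : ∀ {t n} → FibRepresentation t n → FibRepresentation (suc t) n
  weaken (xs , g , xs≤t , Σ≡n) = xs , g , All.map m≤n⇒m≤1+n xs≤t , Σ≡n
  extend : ∀ {t n} → FibRepresentation t n → FibRepresentation (2 + t) (n + fib (2 + t))
  extend {t} (xs , g , xs≤t , refl) =
    xs ++ 2 + t ∷ [] ,
    GappedFrom-++ g (All.map (s≤s ∘ s≤s) xs≤t) (s≤s (s≤s z≤n)) [] ,
    ++⁺ (All.map (m≤n⇒m≤1+n ∘ m≤n⇒m≤1+n) xs≤t) (≤-refl ∷ []) ,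
    sum-map-∷ʳ fib xs (2 + t)

value-surjective : ∀ n → ∃[ w ] value w ≡ n
value-surjective n with fib-representation (suc n) (n<fib[2+n] n)
... | xs , g , _ , Σ≡n with GappedFrom⇒positions g
... | w , refl = w , trans (sym (+-identityʳ (value w))) (trans (sym (sum-positions (λ _ → refl) 0 w)) Σ≡n)

GappedFrom-sums⇔ : ∀ {X} → FibonacciRecurrence X → ∀ c {s} →
                   (∃[ hi ] GappedFrom (2 + c) hi × sum (map X hi) ≡ s)
                   ⇔ (∃₂ λ n m → ⌊ suc n /Φ⌋≡ m × X c * m + X (suc c) * n ≡ s)
GappedFrom-sums⇔ {X} rec c = mk⇔ to from
  where
  to : ∀ {s} → ∃[ hi ] GappedFrom (2 + c) hi × sum (map X hi) ≡ s →
       ∃₂ λ n m → ⌊ suc n /Φ⌋≡ m × X c * m + X (suc c) * n ≡ s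
  to (hi , g , refl) with GappedFrom⇒positions g
  ... | w , refl = value w , shiftedValue w , shiftedValue-floor w , sym (sum-positions rec c w)
  from : ∀ {s} → ∃₂ (λ n m → ⌊ suc n /Φ⌋≡ m × X c * m + X (suc c) * n ≡ s) →
         ∃[ hi ] GappedFrom (2 + c) hi × sum (map X hi) ≡ s
  from (n , m , fl , refl) with value-surjective n
  ... | w , refl with ⌊/Φ⌋-unique {suc n} fl (shiftedValue-floor w)
  ... | refl = positions (2 + c) w , GappedFrom-positions (2 + c) w , sum-positions rec c w

L-suc-mono : ∀ {i j} → i ≤ j → L (suc i) ≤ L (suc j)
L-suc-mono {j = zero}  z≤n = ≤-refl
L-suc-mono {i} {suc j} i≤1+j with m≤n⇒m<n∨m≡n i≤1+j
... | inj₁ i<1+j = ≤-trans (L-suc-mono (≤-pred i<1+j)) (m≤m+n _ _)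
... | inj₂ refl  = ≤-refl

L-pos : ∀ k → 0 < L k
L-pos zero    = s≤s z≤n
L-pos (suc k) = L-suc-mono {0} {k} z≤n

-- The summand L (suc c) makes the bound telescope: L x + L (suc c) ≤ L x + L (x ∸ 1) = L (suc x).
sum-L-GappedFrom≤ : ∀ {c t xs} → GappedFrom (2 + c) xs → All (_≤ t) xs → c ≤ t →
                    sum (map L xs) + L (suc c) ≤ L (suc t)
sum-L-GappedFrom≤ [] [] c≤t = L-suc-mono c≤t
sum-L-GappedFrom≤ {c} {t} (_∷_ {x = suc (suc x)} {xs} (s≤s (s≤s c≤x)) g) (2+x≤t ∷ xs≤t) _ = begin
  L (2 + x) + S + L (suc c)    ≤⟨ +-monoʳ-≤ (L (2 + x) + S) (L-suc-mono c≤x) ⟩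
  L (2 + x) + S + L (suc x)    ≡⟨ xy∙z≈y∙xz (L (2 + x)) S (L (suc x)) ⟩
  S + L (3 + x)                ≤⟨ sum-L-GappedFrom≤ g xs≤t 2+x≤t ⟩
  L (suc t)                    ∎
  where
  open ≤-Reasoning
  S = sum (map L xs)

sum-L-admissible< : ∀ {t xs} → GappedFrom 0 xs → ¬ (0 ∈ xs × 2 ∈ xs) → All (_≤ suc t) xs →
                    sum (map L xs) < L (2 + t)
sum-L-admissible< {t} [] _ _ = L-pos (2 + t)
sum-L-admissible< {t} (_∷_ {x = 0} {xs} _ g) adm (_ ∷ xs≤) =
  subst (_≤ L (2 + t)) (+-comm (sum (map L xs)) 3)
        (sum-L-GappedFrom≤ (GappedFrom-suc g (λ 2∈ → adm (here refl , there 2∈))) xs≤ (s≤s z≤n))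
sum-L-admissible< {t} (_∷_ {x = 1} {xs} _ g) _ (_ ∷ xs≤) =
  ≤-trans (n≤1+n _) (subst (_≤ L (2 + t)) (+-comm (sum (map L xs)) 3) (sum-L-GappedFrom≤ g xs≤ (s≤s z≤n)))
sum-L-admissible< {t} {xs} (_∷_ {x = suc (suc x)} _ g) _ xs≤ =
  subst (_≤ L (2 + t)) (+-comm (sum (map L xs)) 1) (sum-L-GappedFrom≤ (s≤s (s≤s z≤n) ∷ g) xs≤ z≤n)

LucasRepresentation : ℕ → ℕ → Set
LucasRepresentation t j = ∃[ xs ] GappedFrom 0 xs × ¬ (0 ∈ xs × 2 ∈ xs) × All (_≤ suc t) xs × sum (map L xs) ≡ j

lucas-representation : ∀ t {j} → j < L (2 + t) → LucasRepresentation t j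
lucas-representation = greedy {λ t → L (suc t)} (λ _ → refl) LucasRepresentation weaken extend base₀ base₁
  where
  weaken : ∀ {t j} → LucasRepresentation t j → LucasRepresentation (suc t) j
  weaken (xs , g , adm , xs≤ , Σ≡j) = xs , g , adm , All.map m≤n⇒m≤1+n xs≤ , Σ≡j
  extend : ∀ {t j} → LucasRepresentation t j → LucasRepresentation (2 + t) (j + L (3 + t))
  extend {t} (xs , g , adm , xs≤ , refl) =
    xs ++ 3 + t ∷ [] ,
    GappedFrom-++ g (All.map (s≤s ∘ s≤s) xs≤) z≤n [] ,
    (λ (0∈ , 2∈) → adm (∈-++-∷⁻-< [] (s≤s z≤n) 0∈ , ∈-++-∷⁻-< [] (s≤s (s≤s (s≤s z≤n))) 2∈)) ,
    ++⁺ (All.map (m≤n⇒m≤1+n ∘ m≤n⇒m≤1+n) xs≤) (≤-refl ∷ []) ,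
    sum-map-∷ʳ L xs (3 + t)
  base₀ : ∀ {j} → j < L 2 → LucasRepresentation 0 j
  base₀ {0} _ = [] , [] , (λ { (() , _) }) , [] , refl
  base₀ {1} _ = 1 ∷ [] , z≤n ∷ [] , (λ { (here () , _) ; (there () , _) }) , ≤-refl ∷ [] , refl
  base₀ {2} _ = 0 ∷ [] , z≤n ∷ [] , (λ { (_ , here ()) ; (_ , there ()) }) , z≤n ∷ [] , refl
  base₀ {suc (suc (suc _))} (s≤s (s≤s (s≤s ())))
  base₁ : ∀ {j} → j < L 3 → LucasRepresentation 1 j
  base₁ (s≤s j≤3) with m≤n⇒m<n∨m≡n j≤3
  ... | inj₁ j<3 = weaken (base₀ j<3)
  ... | inj₂ refl = 2 ∷ [] , z≤n ∷ [] , (λ { (here () , _) ; (there () , _) }) , ≤-refl ∷ [] , refl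

Decomposition : ℕ → ℕ → Set
Decomposition k N =
  ∃₂ λ lo hi → (GappedFrom 0 lo × All (λ x → 2 + x ≤ k) lo × GappedFrom (2 + k) hi)
             × ¬ (0 ∈ lo ++ k ∷ hi × 2 ∈ lo ++ k ∷ hi)
             × sum (map L lo) + (L k + sum (map L hi)) ≡ N

Z⇔decomposition : ∀ {k N} → Z k N ⇔ Decomposition k N
Z⇔decomposition {k} = mk⇔ to from
  where
  to : ∀ {N} → Z k N → Decomposition k N
  to (_ , I , (gapped , adm) , ΣI≡N , k∈I) with split-at (Gapped⇒GappedFrom gapped) k∈I
  ... | lo , hi , refl , glo , lo<k , ghi =
    lo , hi , (glo , lo<k , ghi) , adm , trans (sym (sum-map-++-∷ L lo k hi)) ΣI≡N
  from : ∀ {N} → Decomposition k N → Z k N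
  from (lo , hi , (glo , lo<k , ghi) , adm , refl) =
    <-≤-trans (L-pos k) (≤-trans (m≤m+n (L k) _) (m≤n+m _ (sum (map L lo)))) ,
    lo ++ k ∷ hi ,
    (GappedFrom⇒Gapped (GappedFrom-++ glo lo<k z≤n ghi) , adm) ,
    sum-map-++-∷ L lo k hi ,
    ∈-++⁺ʳ lo (here refl)

Z0⇔upper-part : ∀ {N} → Z 0 N ⇔ (∃[ hi ] GappedFrom 3 hi × 2 + sum (map L hi) ≡ N)
Z0⇔upper-part = mk⇔ to from
  where
  to : ∀ {N} → Z 0 N → ∃[ hi ] GappedFrom 3 hi × 2 + sum (map L hi) ≡ N
  to z with Equivalence.to Z⇔decomposition z
  ... | [] , hi , (_ , _ , ghi) , adm , eq = hi , GappedFrom-suc ghi (λ 2∈ → adm (here refl , there 2∈)) , eq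
  ... | _ ∷ _ , _ , (_ , () ∷ _ , _) , _
  from : ∀ {N} → ∃[ hi ] GappedFrom 3 hi × 2 + sum (map L hi) ≡ N → Z 0 N
  from (hi , ghi , eq) = Equivalence.from Z⇔decomposition
    ([] , hi , ([] , [] , GappedFrom-weaken (n≤1+n 2) ghi) , adm , eq)
    where
    adm : ¬ (0 ∈ 0 ∷ hi × 2 ∈ 0 ∷ hi)
    adm (_ , here ())
    adm (_ , there 2∈) = <-irrefl refl (GappedFrom-∈ ghi 2∈)

Z1⇔upper-part : ∀ {N} → Z 1 N ⇔ (∃[ hi ] GappedFrom 3 hi × 1 + sum (map L hi) ≡ N)
Z1⇔upper-part = mk⇔ to from
  where
  to : ∀ {N} → Z 1 N → ∃[ hi ] GappedFrom 3 hi × 1 + sum (map L hi) ≡ N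
  to z with Equivalence.to Z⇔decomposition z
  ... | [] , hi , (_ , _ , ghi) , _ , eq = hi , ghi , eq
  ... | _ ∷ _ , _ , (_ , s≤s () ∷ _ , _) , _
  from : ∀ {N} → ∃[ hi ] GappedFrom 3 hi × 1 + sum (map L hi) ≡ N → Z 1 N
  from (hi , ghi , eq) = Equivalence.from Z⇔decomposition
    ([] , hi , ([] , [] , ghi) , (λ (0∈ , _) → ∉[] (∈-++-∷⁻-< ghi (s≤s z≤n) 0∈)) , eq)

lower-sum< : ∀ p {lo hi} → GappedFrom 0 lo → All (λ x → 2 + x ≤ 2 + p) lo →
             ¬ (0 ∈ lo ++ 2 + p ∷ hi × 2 ∈ lo ++ 2 + p ∷ hi) → sum (map L lo) < L (suc p)
lower-sum< zero    []                     _                       _   = s≤s z≤n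
lower-sum< zero    {0 ∷ lo}               _                       _   adm =
  ⊥-elim (adm (here refl , ∈-++⁺ʳ (0 ∷ lo) (here refl)))
lower-sum< zero    {suc _ ∷ _}            _   (s≤s (s≤s ()) ∷ _)  _
lower-sum< (suc q) glo lo<k adm =
  sum-L-admissible< glo (λ (0∈ , 2∈) → adm (∈-++⁺ˡ 0∈ , ∈-++⁺ˡ 2∈)) (All.map (≤-pred ∘ ≤-pred) lo<k)

lower-part : ∀ p {j hi} → j < L (suc p) → GappedFrom (4 + p) hi →
             ∃[ lo ] (GappedFrom 0 lo × All (λ x → 2 + x ≤ 2 + p) lo)
                   × ¬ (0 ∈ lo ++ 2 + p ∷ hi × 2 ∈ lo ++ 2 + p ∷ hi) × sum (map L lo) ≡ j
lower-part zero    {zero}  _ ghi = [] , ([] , []) , (λ (0∈ , _) → ∉[] (∈-++-∷⁻-< ghi (s≤s z≤n) 0∈)) , refl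
lower-part zero    {suc _} (s≤s ()) _
lower-part (suc q) j<L ghi with lucas-representation q j<L
... | lo , glo , adm , lo≤ , Σ≡j =
  lo , (glo , All.map (s≤s ∘ s≤s) lo≤) ,
  (λ (0∈ , 2∈) → adm (∈-++-∷⁻-< ghi (s≤s z≤n) 0∈ , ∈-++-∷⁻-< ghi (s≤s (s≤s (s≤s z≤n))) 2∈)) ,
  Σ≡j

Z2+⇔parts : ∀ p {N} → Z (2 + p) N ⇔
       (∃₂ λ j hi → j < L (suc p) × GappedFrom (4 + p) hi × j + (L (2 + p) + sum (map L hi)) ≡ N)
Z2+⇔parts p = mk⇔ to from
  where
  to : ∀ {N} → Z (2 + p) N → ∃₂ λ j hi → j < L (suc p) × GappedFrom (4 + p) hi × j + (L (2 + p) + sum (map L hi)) ≡ N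
  to z with Equivalence.to Z⇔decomposition z
  ... | lo , hi , (glo , lo<k , ghi) , adm , eq = sum (map L lo) , hi , lower-sum< p glo lo<k adm , ghi , eq
  from : ∀ {N} → ∃₂ (λ j hi → j < L (suc p) × GappedFrom (4 + p) hi × j + (L (2 + p) + sum (map L hi)) ≡ N) → Z (2 + p) N
  from (j , hi , j<L , ghi , refl) with lower-part p j<L ghi
  ... | lo , (glo , lo<k) , adm , refl = Equivalence.from Z⇔decomposition (lo , hi , (glo , lo<k , ghi) , adm , refl)

Z0-characterization : ∀ N → Z 0 N ⇔ (∃[ n ] ∃[ m ] (IsFloorDivΦ (+ suc n) (+ 0) m × N ≡ 2 + 3 * n + m))
Z0-characterization N = mk⇔ to from
  where
  sums⇔ = GappedFrom-sums⇔ {L} (λ _ → refl) 1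
  arith : ∀ n m → 2 + (1 * m + 3 * n) ≡ 2 + 3 * n + m
  arith = solve-∀
  to : Z 0 N → ∃[ n ] ∃[ m ] (IsFloorDivΦ (+ suc n) (+ 0) m × N ≡ 2 + 3 * n + m)
  to z with Equivalence.to Z0⇔upper-part z
  ... | hi , ghi , ΣN with Equivalence.to sums⇔ (hi , ghi , refl)
  ... | n , m , fl , Σhi =
    n , m , Equivalence.from (isFloorDivΦ⇔ n m) fl , trans (sym ΣN) (trans (cong (λ t → 2 + t) (sym Σhi)) (arith n m))
  from : ∃[ n ] ∃[ m ] (IsFloorDivΦ (+ suc n) (+ 0) m × N ≡ 2 + 3 * n + m) → Z 0 N
  from (n , m , fl , N≡) with Equivalence.from sums⇔ (n , m , Equivalence.to (isFloorDivΦ⇔ n m) fl , refl)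
  ... | hi , ghi , Σhi =
    Equivalence.from Z0⇔upper-part (hi , ghi , trans (cong (λ t → 2 + t) Σhi) (trans (arith n m) (sym N≡)))

Z1-characterization : ∀ N → Z 1 N ⇔ (∃[ n ] ∃[ m ] (IsFloorDivΦ (+ suc n) (+ 1) m × N ≡ 3 * n + m))
Z1-characterization N = mk⇔ to from
  where
  sums⇔ = GappedFrom-sums⇔ {L} (λ _ → refl) 1
  arith : ∀ n m → 1 + (1 * m + 3 * n) ≡ 3 * n + suc m
  arith = solve-∀
  to : Z 1 N → ∃[ n ] ∃[ m ] (IsFloorDivΦ (+ suc n) (+ 1) m × N ≡ 3 * n + m)
  to z with Equivalence.to Z1⇔upper-part z
  ... | hi , ghi , ΣN with Equivalence.to sums⇔ (hi , ghi , refl)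
  ... | n , m , fl , Σhi =
    n , suc m , Equivalence.from (isFloorDivΦ-Φ²⇔ n (suc m)) (m , refl , fl) ,
    trans (sym ΣN) (trans (cong (λ t → 1 + t) (sym Σhi)) (arith n m))
  from : ∃[ n ] ∃[ m ] (IsFloorDivΦ (+ suc n) (+ 1) m × N ≡ 3 * n + m) → Z 1 N
  from (n , m , fl , N≡) with Equivalence.to (isFloorDivΦ-Φ²⇔ n m) fl
  ... | m′ , refl , fl′ with Equivalence.from sums⇔ (n , m′ , fl′ , refl)
  ... | hi , ghi , Σhi =
    Equivalence.from Z1⇔upper-part (hi , ghi , trans (cong (λ t → 1 + t) Σhi) (trans (arith n m′) (sym N≡)))

Z2+-characterization : ∀ p N → Z (2 + p) N ⇔
  (∃[ n ] ∃[ m ] ∃[ j ] (IsFloorDivΦ (+ suc n) (+ 1) m × j < L (suc p) × N ≡ L (2 + p) * m + n * L (3 + p) + j))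
Z2+-characterization p N = mk⇔ to from
  where
  k = 2 + p
  sums⇔ = GappedFrom-sums⇔ {L} (λ _ → refl) k
  arith : ∀ a b n m j → j + (a + (a * m + b * n)) ≡ a * suc m + n * b + j
  arith = solve-∀
  to : Z k N → ∃[ n ] ∃[ m ] ∃[ j ] (IsFloorDivΦ (+ suc n) (+ 1) m × j < L (suc p) × N ≡ L k * m + n * L (suc k) + j)
  to z with Equivalence.to (Z2+⇔parts p) z
  ... | j , hi , j<L , ghi , ΣN with Equivalence.to sums⇔ (hi , ghi , refl)
  ... | n , m , fl , Σhi =
    n , suc m , j , Equivalence.from (isFloorDivΦ-Φ²⇔ n (suc m)) (m , refl , fl) , j<L ,
    trans (sym ΣN) (trans (cong (λ t → j + (L k + t)) (sym Σhi)) (arith (L k) (L (suc k)) n m j))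
  from : ∃[ n ] ∃[ m ] ∃[ j ] (IsFloorDivΦ (+ suc n) (+ 1) m × j < L (suc p) × N ≡ L k * m + n * L (suc k) + j) → Z k N
  from (n , m , j , fl , j<L , N≡) with Equivalence.to (isFloorDivΦ-Φ²⇔ n m) fl
  ... | m′ , refl , fl′ with Equivalence.from sums⇔ (n , m′ , fl′ , refl)
  ... | hi , ghi , Σhi = Equivalence.from (Z2+⇔parts p)
    (j , hi , j<L , ghi , trans (cong (λ t → j + (L k + t)) Σhi) (trans (arith (L k) (L (suc k)) n m′ j) (sym N≡)))

theorem1p4 : (∀ N → Z 0 N ⇔ (∃[ n ] ∃[ m ] (IsFloorDivΦ (+ suc n) (+ 0) m × N ≡ 2 + 3 * n + m)))
    × (∀ N → Z 1 N ⇔ (∃[ n ] ∃[ m ] (IsFloorDivΦ (+ suc n) (+ 1) m × N ≡ 3 * n + m)))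
    × (∀ k → 2 ≤ k → ∀ N → Z k N ⇔
        (∃[ n ] ∃[ m ] ∃[ j ] (IsFloorDivΦ (+ suc n) (+ 1) m × j < L (k ∸ 1)
          × N ≡ L k * m + n * L (suc k) + j)))
theorem1p4 = Z0-characterization , Z1-characterization , λ where
  (suc (suc p)) _ → Z2+-characterization p
  (suc zero) (s≤s ())
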